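{- Let $\mathbb F_q$ be a finite field with $q$ odd, let $\eta$ be a character of $\mathbb F_q^\times$ of order $N>2$, and let $z\in\mathbb F_q$ with $z\neq 0,1$. Set $N'=N$, $\eta'=\eta$ if $N$ is even, and $N'=2N$, $\eta'=\phi\overline\eta$ if $N$ is odd, and define $$S_{\eta'}(z)=\sum_{x\in\mathbb F_q}\eta'\!\left(x^{N'/2-1}(x-1)(x-z)\right).$$ Then $${}_2F_1\left(\begin{matrix}\phi\eta & \eta\\ & \phi\end{matrix};z\right)=\frac{\phi\eta(-1)}{q}\cdot\begin{cases}\overline\eta(1-z)^2\,S_{\eta'}(z), & N \text{ even},\\ S_{\eta'}(z), & N\text{ odd}.\end{cases}$$
   Context: All multiplicative characters of $\mathbb F_q^\times$ (including the trivial character $\varepsilon$) are extended to $\mathbb F_q$ by setting their value at $0$ equal to $0$. $\phi$ is the quadratic character, $\overline{A}$ the inverse character of $A$. For characters $A,B,C$ and $x\in\mathbb F_q$, $${}_2F_1\left(\begin{matrix}A & B\\ & C\end{matrix};x\right)=\varepsilon(x)\frac{BC(-1)}{q}\sum_{y\in\mathbb F_q}B(y)\,(C\overline B)(1-y)\,\overline A(1-xy).$$ -}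

module Defs where

open import Data.Nat as ℕ using (ℕ; zero; suc; _<_; ⌊_/2⌋; _∸_)
open import Data.List using (List; []; _∷_; length; foldr)
open import Data.List.Membership.Propositional using (_∈_)
open import Data.List.Relation.Unary.Unique.Propositional using (Unique)
open import Data.List.Relation.Unary.Any using (any?)
open import Data.Product using (Σ; ∃; _×_; _,_)
open import Data.Empty using (⊥-elim)
open import Relation.Nullary using (¬_; yes; no)
open import Relation.Binary.PropositionalEquality using (_≡_; _≢_; refl)
open import Relation.Binary.Definitions using (DecidableEquality)
open import Algebra.Core using (Op₁; Op₂)
open import Algebra.Structures using (IsCommutativeRing)

record FiniteField : Set₁ where
  infixl 7 _*_
  infixl 6 _+_ _-_
  infix  8 -_
  infixr 8 _^_
  field
    Carrier           : Set
    _+_               : Op₂ Carrier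
    _*_               : Op₂ Carrier
    -_                : Op₁ Carrier
    0#                : Carrier
    1#                : Carrier
    isCommutativeRing : IsCommutativeRing _≡_ _+_ _*_ -_ 0# 1#
    0≢1               : 0# ≢ 1#
    inverse           : ∀ x → x ≢ 0# → Σ Carrier (λ y → x * y ≡ 1#)
    _≟_               : DecidableEquality Carrier
    elements          : List Carrier
    complete          : ∀ x → x ∈ elements
    unique            : Unique elements

  size : ℕ
  size = length elements

  _-_ : Op₂ Carrier
  x - y = x + (- y)

  -- x ↦ x⁻¹ on F_q^×, extended by 0 ↦ 0
  inv : Op₁ Carrier
  inv x with x ≟ 0#
  ... | yes _  = 0#
  ... | no x≢0 = Data.Product.proj₁ (inverse x x≢0)

  _^_ : Carrier → ℕ → Carrier
  x ^ zero  = 1#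
  x ^ suc n = x * (x ^ n)

  sumOver : {A : Set} → Op₂ A → A → (Carrier → A) → A
  sumOver _⊕_ e f = foldr (λ x acc → f x ⊕ acc) e elements

natMul : {A : Set} → Op₂ A → A → A → ℕ → A
natMul _⊕_ e a zero    = e
natMul _⊕_ e a (suc n) = a ⊕ natMul _⊕_ e a n

-- The field in which characters take values (playing the role of ℂ):
-- a field of characteristic zero.

record CharZeroField : Set₁ where
  infixl 7 _*_
  infixl 6 _+_
  infix  8 -_
  infixr 8 _^_
  field
    Carrier           : Set
    _+_               : Op₂ Carrier
    _*_               : Op₂ Carrier
    -_                : Op₁ Carrier
    0#                : Carrier
    1#                : Carrier
    isCommutativeRing : IsCommutativeRing _≡_ _+_ _*_ -_ 0# 1#
    inverse           : ∀ x → x ≢ 0# → Σ Carrier (λ y → x * y ≡ 1#)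

    charZero          : ∀ n → natMul _+_ 0# 1# (suc n) ≢ 0#

  fromℕ : ℕ → Carrier
  fromℕ = natMul _+_ 0# 1#

  _^_ : Carrier → ℕ → Carrier
  x ^ zero  = 1#
  x ^ suc n = x * (x ^ n)

module _ (F : FiniteField) (K : CharZeroField) where
  private
    module F = FiniteField F
    module K = CharZeroField K

  Char : Set
  Char = F.Carrier → K.Carrier

  -- χ is (the zero-extension of) a homomorphism F_q^× → K^×
  record IsCharacter (χ : Char) : Set where
    field
      at-0 : χ F.0# ≡ K.0#
      at-1 : χ F.1# ≡ K.1#
      mult : ∀ x y → χ (x F.* y) ≡ χ x K.* χ y

  εχ : Char
  εχ x with x F.≟ F.0#
  ... | yes _ = K.0#
  ... | no  _ = K.1#

  φ : Char
  φ x with x F.≟ F.0#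
  ... | yes _ = K.0#
  ... | no  _ with any? (λ y → (y F.* y) F.≟ x) F.elements
  ...   | yes _ = K.1#
  ...   | no  _ = K.- K.1#

  _·χ_ : Char → Char → Char
  (A ·χ B) x = A x K.* B x

  bar : Char → Char
  bar A x = A (F.inv x)

  _^χ_ : Char → ℕ → Char
  (χ ^χ zero)  = εχ
  (χ ^χ suc k) = χ ·χ (χ ^χ k)

  HasOrder : Char → ℕ → Set
  HasOrder χ N = (0 < N) × (∀ x → (χ ^χ N) x ≡ εχ x)
                 × (∀ k → 0 < k → k < N → ¬ (∀ x → (χ ^χ k) x ≡ εχ x))

  private
    size-pos : ∀ {xs : List F.Carrier} → F.0# ∈ xs → Σ ℕ (λ m → length xs ≡ suc m)
    size-pos {x ∷ xs} _ = length xs , refl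

  q⁻¹ : K.Carrier
  q⁻¹ with size-pos (F.complete F.0#)
  ... | m , _ = Data.Product.proj₁ (K.inverse (K.fromℕ (suc m)) (K.charZero m))

  sumK : (F.Carrier → K.Carrier) → K.Carrier
  sumK = F.sumOver K._+_ K.0#

  -- Greene's finite field hypergeometric function 2F1(A B; C; x)
  ₂F₁ : Char → Char → Char → F.Carrier → K.Carrier
  ₂F₁ A B C x =
    εχ x K.* ((B ·χ C) (F.- F.1#) K.* q⁻¹) K.*
      sumK (λ y → B y K.* ((C ·χ bar B) (F.1# F.- y)) K.* bar A (F.1# F.- (x F.* y)))

  S : ℕ → Char → F.Carrier → K.Carrier
  S N' η' z = sumK (λ x → η' ((x F.^ (⌊ N' /2⌋ ∸ 1)) F.* (x F.- F.1#) F.* (x F.- z)))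

{-# OPTIONS --safe #-}
module Submission where

-- Write ψ = φη̄.  Since φ(t⁻¹) = φ(t), the inverse of φη is ψ, so the hypergeometric sum
-- is (φη)(-1) q⁻¹ Σ_y η(y) ψ(1-y) ψ(1-zy).  For odd N = 2k+1 the substitution x = 1/y
-- turns this into S_ψ(z), because ψ(1/y)^(2k+2) = η(y)^(2k+2) = η(y).  For even N = 2h
-- the character η^h has order two, hence equals φ (by counting, a product of two
-- nonsquares is a square), so η^(h-1) = ψ; the Möbius substitution x = z + (z-1)/(y-1)
-- then turns S_η(z) into η(z-1)² times the same sum.

open import Defs
open import Algebra.Bundles using (CommutativeRing; RawRing)
open import Algebra.Core using (Op₁; Op₂)
open import Algebra.Structures using (IsCommutativeMonoid; IsCommutativeRing)
import Algebra.Solver.Ring.AlmostCommutativeRing as ACR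
open import Data.Bool using (true; false; if_then_else_)
open import Data.Empty using (⊥-elim)
open import Data.Fin using (toℕ)
import Data.Fin.Properties as Fin
open import Data.Integer as ℤ using (ℤ; -[1+_]; _⊖_)
import Data.Integer.Properties as ℤ
open import Data.List using (List; []; _∷_; foldr; length; lookup)
open import Data.List.Membership.Propositional using (_∈_)
open import Data.List.Relation.Unary.All as All using (All; []; _∷_)
open import Data.List.Relation.Unary.AllPairs using ([]; _∷_)
open import Data.List.Relation.Unary.Any as Any using (Any; any?; here; there)
import Data.List.Relation.Unary.Any.Properties as Any
open import Data.List.Relation.Unary.Unique.Propositional using (Unique)
open import Data.Maybe using (Maybe; just; nothing)
open import Data.Nat as ℕ using (ℕ; zero; suc; _<_; _<?_; ⌊_/2⌋; _∸_; s≤s; z≤n)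
import Data.Nat.Properties as ℕ
open import Data.Nat.Divisibility using (_∣_; divides)
open import Data.Product using (Σ; _×_; _,_; proj₂)
open import Data.Sum using (_⊎_; inj₁; inj₂)
open import Function.Bundles using (mk⇔)
open import Level using (0ℓ)
open import Relation.Nullary using (Dec; yes; no; ¬_; does)
open import Relation.Nullary.Decidable using (_×-dec_; ¬?; does-⇔)
open import Relation.Binary.PropositionalEquality

-- Normal forms are compared by evaluation, so coefficients must compute: they are taken
-- in ℤ and interpreted in the ring as multiples of 1#.
module IntegerCoefficientSolver
  {A : Set} {add mul : Op₂ A} {neg : Op₁ A} {zero# one# : A}
  (isCR : IsCommutativeRing _≡_ add mul neg zero# one#) where

  private
    R : CommutativeRing 0ℓ 0ℓ
    R = record { isCommutativeRing = isCR }
    open CommutativeRing R hiding (sym; trans; refl)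
    open import Algebra.Properties.Ring ring
      using (-‿distribˡ-*; -‿distribʳ-*; -‿involutive; -‿+-comm; -0#≈0#)
    open import Algebra.Properties.Semiring.Mult.TCOptimised semiring
      using (×-homo-+; ×1-homo-*; 1+×) renaming (_×_ to _×′_)

    ι : ℕ → A
    ι n = n ×′ 1#

    ⟦_⟧ : ℤ → A
    ⟦ ℤ.+ n ⟧    = ι n
    ⟦ -[1+ n ] ⟧ = - ι (suc n)

    [1+a]-[1+b] : ∀ a b → (1# + a) - (1# + b) ≡ a - b
    [1+a]-[1+b] a b = begin
      (1# + a) - (1# + b)       ≡⟨ cong ((1# + a) +_) (sym (-‿+-comm 1# b)) ⟩
      (1# + a) + (- 1# + - b)   ≡⟨ cong (_+ (- 1# + - b)) (+-comm 1# a) ⟩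
      (a + 1#) + (- 1# + - b)   ≡⟨ +-assoc a 1# _ ⟩
      a + (1# + (- 1# + - b))   ≡⟨ cong (a +_) (sym (+-assoc 1# (- 1#) (- b))) ⟩
      a + ((1# - 1#) + - b)     ≡⟨ cong (λ t → a + (t + - b)) (-‿inverseʳ 1#) ⟩
      a + (0# + - b)            ≡⟨ cong (a +_) (+-identityˡ (- b)) ⟩
      a - b                     ∎
      where open ≡-Reasoning

    ⊖-homo : ∀ m n → ⟦ m ⊖ n ⟧ ≡ ι m - ι n
    ⊖-homo zero    zero    = sym (-‿inverseʳ 0#)
    ⊖-homo zero    (suc n) = sym (+-identityˡ _)
    ⊖-homo (suc m) zero    = sym (trans (cong (ι (suc m) +_) -0#≈0#) (+-identityʳ _))
    ⊖-homo (suc m) (suc n) =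
      trans (cong ⟦_⟧ (ℤ.[1+m]⊖[1+n]≡m⊖n m n))
        (trans (⊖-homo m n)
          (trans (sym ([1+a]-[1+b] (ι m) (ι n)))
            (cong₂ _-_ (sym (1+× m 1#)) (sym (1+× n 1#)))))

    +-homo : ∀ i j → ⟦ i ℤ.+ j ⟧ ≡ ⟦ i ⟧ + ⟦ j ⟧
    +-homo (ℤ.+ m)  (ℤ.+ n)  = ×-homo-+ 1# m n
    +-homo (ℤ.+ m)  -[1+ n ] = ⊖-homo m (suc n)
    +-homo -[1+ m ] (ℤ.+ n)  = trans (⊖-homo n (suc m)) (+-comm _ _)
    +-homo -[1+ m ] -[1+ n ] =
      trans (cong -_ (trans (cong ι (cong suc (sym (ℕ.+-suc m n)))) (×-homo-+ 1# (suc m) (suc n))))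
        (sym (-‿+-comm _ _))

    -‿homo : ∀ i → ⟦ ℤ.- i ⟧ ≡ - ⟦ i ⟧
    -‿homo (ℤ.+ zero)  = sym -0#≈0#
    -‿homo (ℤ.+ suc n) = refl
    -‿homo -[1+ n ]    = sym (-‿involutive _)

    *-homo : ∀ i j → ⟦ i ℤ.* j ⟧ ≡ ⟦ i ⟧ * ⟦ j ⟧
    *-homo (ℤ.+ m)  (ℤ.+ n)  = trans (cong ⟦_⟧ (ℤ.+◃n≡+n (m ℕ.* n))) (×1-homo-* m n)
    *-homo (ℤ.+ m)  -[1+ n ] = trans (cong ⟦_⟧ (ℤ.-◃n≡-n (m ℕ.* suc n)))
      (trans (-‿homo (ℤ.+ (m ℕ.* suc n))) (trans (cong -_ (×1-homo-* m (suc n))) (-‿distribʳ-* _ _)))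
    *-homo -[1+ m ] (ℤ.+ n)  = trans (cong ⟦_⟧ (ℤ.-◃n≡-n (suc m ℕ.* n)))
      (trans (-‿homo (ℤ.+ (suc m ℕ.* n))) (trans (cong -_ (×1-homo-* (suc m) n)) (-‿distribˡ-* _ _)))
    *-homo -[1+ m ] -[1+ n ] = trans (cong ⟦_⟧ (ℤ.+◃n≡+n (suc m ℕ.* suc n)))
      (trans (×1-homo-* (suc m) (suc n))
        (trans (sym (-‿involutive _)) (trans (cong -_ (-‿distribˡ-* _ _)) (-‿distribʳ-* _ _))))

    ℤ-rawRing : RawRing 0ℓ 0ℓ
    ℤ-rawRing = record
      { Carrier = ℤ ; _≈_ = _≡_ ; _+_ = ℤ._+_ ; _*_ = ℤ._*_ ; -_ = ℤ.-_ ; 0# = ℤ.+ 0 ; 1# = ℤ.+ 1 }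

    homomorphism : ℤ-rawRing ACR.-Raw-AlmostCommutative⟶ ACR.fromCommutativeRing R
    homomorphism = record
      { ⟦_⟧ = ⟦_⟧ ; +-homo = +-homo ; *-homo = *-homo ; -‿homo = -‿homo ; 0-homo = refl ; 1-homo = refl }

    ⟦⟧-≟ : ∀ i j → Maybe (⟦ i ⟧ ≡ ⟦ j ⟧)
    ⟦⟧-≟ i j with i ℤ.≟ j
    ... | yes i≡j = just (cong ⟦_⟧ i≡j)
    ... | no  _   = nothing

  open import Algebra.Solver.Ring ℤ-rawRing (ACR.fromCommutativeRing R) homomorphism ⟦⟧-≟ public
    using (solve; _:=_; _:+_; _:*_; _:-_; :-_; con)

module FieldSums (F : FiniteField) {A : Set} {_⊕_ : Op₂ A} {e : A}
                 (isCM : IsCommutativeMonoid _≡_ _⊕_ e) where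

  open FiniteField F using (Carrier; elements; complete; unique; _≟_)
  open IsCommutativeMonoid isCM using (assoc; comm; identityˡ; identityʳ)

  sumList : List Carrier → (Carrier → A) → A
  sumList xs f = foldr (λ x acc → f x ⊕ acc) e xs

  ∑ : (Carrier → A) → A
  ∑ = sumList elements

  sumList-cong : ∀ xs {f g} → (∀ x → f x ≡ g x) → sumList xs f ≡ sumList xs g
  sumList-cong []       f≗g = refl
  sumList-cong (x ∷ xs) f≗g = cong₂ _⊕_ (f≗g x) (sumList-cong xs f≗g)

  ∑-cong : ∀ {f g} → (∀ x → f x ≡ g x) → ∑ f ≡ ∑ g
  ∑-cong = sumList-cong elements

  private
    interchange : ∀ a b c d → (a ⊕ b) ⊕ (c ⊕ d) ≡ (a ⊕ c) ⊕ (b ⊕ d)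
    interchange a b c d = trans (assoc a b _)
      (trans (cong (a ⊕_) (trans (sym (assoc b c d)) (trans (cong (_⊕ d) (comm b c)) (assoc c b d))))
        (sym (assoc a c _)))

  sumList-distrib : ∀ xs f g → sumList xs (λ x → f x ⊕ g x) ≡ sumList xs f ⊕ sumList xs g
  sumList-distrib []       f g = sym (identityˡ e)
  sumList-distrib (x ∷ xs) f g =
    trans (cong ((f x ⊕ g x) ⊕_) (sumList-distrib xs f g)) (interchange _ _ _ _)

  ∑-distrib : ∀ f g → ∑ (λ x → f x ⊕ g x) ≡ ∑ f ⊕ ∑ g
  ∑-distrib = sumList-distrib elements

  sumList-zero : ∀ xs → sumList xs (λ _ → e) ≡ e
  sumList-zero []       = refl
  sumList-zero (x ∷ xs) = trans (cong (e ⊕_) (sumList-zero xs)) (identityˡ e)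

  ∑-zero : ∑ (λ _ → e) ≡ e
  ∑-zero = sumList-zero elements

  sumList-swap : ∀ xs ys (h : Carrier → Carrier → A) →
                 sumList xs (λ x → sumList ys (h x)) ≡ sumList ys (λ y → sumList xs (λ x → h x y))
  sumList-swap []       ys h = sym (sumList-zero ys)
  sumList-swap (x ∷ xs) ys h = trans (cong (sumList ys (h x) ⊕_) (sumList-swap xs ys h))
    (sym (sumList-distrib ys (h x) (λ y → sumList xs (λ x′ → h x′ y))))

  ∑-swap : ∀ (h : Carrier → Carrier → A) → ∑ (λ x → ∑ (h x)) ≡ ∑ (λ y → ∑ (λ x → h x y))
  ∑-swap = sumList-swap elements elements

  sumList-pick-absent : ∀ c (g : Carrier → A) xs → All (λ x → x ≢ c) xs →
                        sumList xs (λ x → if does (x ≟ c) then g x else e) ≡ e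
  sumList-pick-absent c g []       []           = refl
  sumList-pick-absent c g (x ∷ xs) (x≢c ∷ xs≢c) with x ≟ c
  ... | yes x≡c = ⊥-elim (x≢c x≡c)
  ... | no  _   = trans (cong (e ⊕_) (sumList-pick-absent c g xs xs≢c)) (identityˡ e)

  sumList-pick : ∀ c (g : Carrier → A) xs → c ∈ xs → Unique xs →
                 sumList xs (λ x → if does (x ≟ c) then g x else e) ≡ g c
  sumList-pick c g (x ∷ xs) c∈ (x≢xs ∷ uniq) with x ≟ c
  ... | yes refl = trans (cong (g x ⊕_) (sumList-pick-absent x g xs (All.map (λ x≢y y≡x → x≢y (sym y≡x)) x≢xs)))
                     (identityʳ _)
  sumList-pick c g (x ∷ xs) (here c≡x)  _ | no x≢c = ⊥-elim (x≢c (sym c≡x))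
  sumList-pick c g (x ∷ xs) (there c∈)  (_ ∷ uniq) | no _ =
    trans (cong (e ⊕_) (sumList-pick c g xs c∈ uniq)) (identityˡ _)

  ∑-pick : ∀ c (g : Carrier → A) → ∑ (λ x → if does (x ≟ c) then g x else e) ≡ g c
  ∑-pick c g = sumList-pick c g elements (complete c) unique

  ∑-reindex : (σ τ : Carrier → Carrier) → (∀ x → τ (σ x) ≡ x) → (∀ y → σ (τ y) ≡ y) →
              ∀ f → ∑ (λ x → f (σ x)) ≡ ∑ f
  ∑-reindex σ τ τσ στ f = begin
    ∑ (λ x → f (σ x))                                            ≡⟨ ∑-cong (λ x → sym (∑-pick (σ x) f)) ⟩
    ∑ (λ x → ∑ (λ y → if does (y ≟ σ x) then f y else e))        ≡⟨ ∑-swap _ ⟩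
    ∑ (λ y → ∑ (λ x → if does (y ≟ σ x) then f y else e))        ≡⟨ ∑-cong (λ y → ∑-cong (λ x →
                                                                      cong (if_then f y else e) (graph y x))) ⟩
    ∑ (λ y → ∑ (λ x → if does (x ≟ τ y) then f y else e))
      ≡⟨ ∑-cong (λ y → ∑-pick (τ y) (λ _ → f y)) ⟩
    ∑ f                                                          ∎
    where
    open ≡-Reasoning
    graph : ∀ y x → does (y ≟ σ x) ≡ does (x ≟ τ y)
    graph y x = does-⇔ (mk⇔ (λ y≡σx → trans (sym (τσ x)) (cong τ (sym y≡σx)))
                            (λ x≡τy → trans (sym (στ y)) (cong σ (sym x≡τy))))
                       (y ≟ σ x) (x ≟ τ y)

module FieldProperties (F : FiniteField) where

  open FiniteField F
  open IntegerCoefficientSolver isCommutativeRing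
  private
    R : CommutativeRing 0ℓ 0ℓ
    R = record { isCommutativeRing = isCommutativeRing }
    module R = CommutativeRing R
    open import Algebra.Properties.Group R.+-group using (x∙y⁻¹≈ε⇒x≈y; ⁻¹-involutive)
    open ≡-Reasoning

  by-cases-at : ∀ {P : Carrier → Set} c → P c → (∀ {y} → y ≢ c → P y) → ∀ y → P y
  by-cases-at c Pc P≢c y with y ≟ c
  ... | yes refl = Pc
  ... | no  y≢c  = P≢c y≢c

  1≢0 : 1# ≢ 0#
  1≢0 1≡0 = 0≢1 (sym 1≡0)

  inv-0 : inv 0# ≡ 0#
  inv-0 with 0# ≟ 0#
  ... | yes _   = refl
  ... | no 0≢0 = ⊥-elim (0≢0 refl)

  inverseʳ : ∀ {x} → x ≢ 0# → x * inv x ≡ 1#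
  inverseʳ {x} x≢0 with x ≟ 0#
  ... | yes x≡0 = ⊥-elim (x≢0 x≡0)
  ... | no  x≢0 = proj₂ (inverse x x≢0)

  inverseˡ : ∀ {x} → x ≢ 0# → inv x * x ≡ 1#
  inverseˡ x≢0 = trans (R.*-comm _ _) (inverseʳ x≢0)

  x*y≡0⇒y≡0 : ∀ {x y} → x * y ≡ 0# → x ≢ 0# → y ≡ 0#
  x*y≡0⇒y≡0 {x} {y} xy≡0 x≢0 = begin
    y                 ≡⟨ sym (R.*-identityˡ y) ⟩
    1# * y            ≡⟨ cong (_* y) (sym (inverseˡ x≢0)) ⟩
    (inv x * x) * y   ≡⟨ R.*-assoc _ _ _ ⟩
    inv x * (x * y)   ≡⟨ cong (inv x *_) xy≡0 ⟩
    inv x * 0#        ≡⟨ R.zeroʳ _ ⟩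
    0#                ∎

  *-≢0 : ∀ {x y} → x ≢ 0# → y ≢ 0# → x * y ≢ 0#
  *-≢0 x≢0 y≢0 xy≡0 = y≢0 (x*y≡0⇒y≡0 xy≡0 x≢0)

  inv-unique : ∀ {x y} → x * y ≡ 1# → inv x ≡ y
  inv-unique {x} {y} xy≡1 = begin
    inv x               ≡⟨ sym (R.*-identityʳ _) ⟩
    inv x * 1#          ≡⟨ cong (inv x *_) (sym xy≡1) ⟩
    inv x * (x * y)     ≡⟨ sym (R.*-assoc _ _ _) ⟩
    (inv x * x) * y     ≡⟨ cong (_* y) (inverseˡ x≢0) ⟩
    1# * y              ≡⟨ R.*-identityˡ y ⟩
    y                   ∎
    where
    x≢0 : x ≢ 0#
    x≢0 x≡0 = 1≢0 (trans (sym xy≡1) (trans (cong (_* y) x≡0) (R.zeroˡ y)))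

  inv-≢0 : ∀ {x} → x ≢ 0# → inv x ≢ 0#
  inv-≢0 {x} x≢0 inv≡0 = 1≢0 (trans (sym (inverseʳ x≢0)) (trans (cong (x *_) inv≡0) (R.zeroʳ x)))

  inv-involutive : ∀ x → inv (inv x) ≡ x
  inv-involutive = by-cases-at 0# (trans (cong inv inv-0) inv-0) (λ x≢0 → inv-unique (inverseˡ x≢0))

  inv-1 : inv 1# ≡ 1#
  inv-1 = inv-unique (R.*-identityˡ 1#)

  inv-distrib-* : ∀ x y → inv (x * y) ≡ inv x * inv y
  inv-distrib-* x y = by-cases (x ≟ 0#) (y ≟ 0#)
    where
    by-cases : Dec (x ≡ 0#) → Dec (y ≡ 0#) → inv (x * y) ≡ inv x * inv y
    by-cases (yes refl) _ = trans (cong inv (R.zeroˡ y)) (trans inv-0 (sym (trans (cong (_* inv y) inv-0) (R.zeroˡ _))))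
    by-cases (no _) (yes refl) = trans (cong inv (R.zeroʳ x)) (trans inv-0 (sym (trans (cong (inv x *_) inv-0) (R.zeroʳ _))))
    by-cases (no x≢0) (no y≢0) = inv-unique (begin
      (x * y) * (inv x * inv y)   ≡⟨ solve 4 (λ x y x′ y′ → (x :* y) :* (x′ :* y′) := (x :* x′) :* (y :* y′))
                                             refl x y _ _ ⟩
      (x * inv x) * (y * inv y)   ≡⟨ cong₂ _*_ (inverseʳ x≢0) (inverseʳ y≢0) ⟩
      1# * 1#                     ≡⟨ R.*-identityˡ 1# ⟩
      1#                          ∎)

  x-y≡0⇒x≡y : ∀ {x y} → x - y ≡ 0# → x ≡ y
  x-y≡0⇒x≡y = x∙y⁻¹≈ε⇒x≈y _ _

  x≢y⇒x-y≢0 : ∀ {x y} → x ≢ y → x - y ≢ 0#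
  x≢y⇒x-y≢0 x≢y x-y≡0 = x≢y (x-y≡0⇒x≡y x-y≡0)

  x*x≡y*y⇒x≡±y : ∀ {x y} → x * x ≡ y * y → x ≡ y ⊎ x ≡ - y
  x*x≡y*y⇒x≡±y {x} {y} xx≡yy with x ≟ y
  ... | yes x≡y = inj₁ x≡y
  ... | no  x≢y = inj₂ (x-y≡0⇒x≡y (trans (cong (x +_) (⁻¹-involutive y)) x+y≡0))
    where
    x+y≡0 : x + y ≡ 0#
    x+y≡0 = x*y≡0⇒y≡0 (begin
      (x - y) * (x + y)   ≡⟨ solve 2 (λ x y → (x :- y) :* (x :+ y) := x :* x :- y :* y) refl x y ⟩
      x * x - y * y       ≡⟨ cong (_- (y * y)) xx≡yy ⟩
      y * y - y * y       ≡⟨ R.-‿inverseʳ _ ⟩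
      0#                  ∎) (x≢y⇒x-y≢0 x≢y)

  IsSquare : Carrier → Set
  IsSquare x = Any (λ y → y * y ≡ x) elements

  isSquare? : ∀ x → Dec (IsSquare x)
  isSquare? x = any? (λ y → (y * y) ≟ x) elements

  square-isSquare : ∀ t → IsSquare (t * t)
  square-isSquare t = Any.map (λ { refl → refl }) (complete t)

  isSquare-* : ∀ {x y} → IsSquare x → IsSquare y → IsSquare (x * y)
  isSquare-* sx sy with Any.satisfied sx | Any.satisfied sy
  ... | s , refl | t , refl = subst IsSquare
    (solve 2 (λ s t → (s :* t) :* (s :* t) := (s :* s) :* (t :* t)) refl s t) (square-isSquare (s * t))

  isSquare-inv : ∀ {x} → IsSquare x → IsSquare (inv x)
  isSquare-inv sx with Any.satisfied sx
  ... | s , refl = subst IsSquare (sym (inv-distrib-* s s)) (square-isSquare (inv s))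

  isSquare-cancelʳ : ∀ {x y} → IsSquare y → y ≢ 0# → IsSquare (x * y) → IsSquare x
  isSquare-cancelʳ {x} {y} sy y≢0 sxy = subst IsSquare x*y*y⁻¹≡x (isSquare-* sxy (isSquare-inv sy))
    where
    x*y*y⁻¹≡x : (x * y) * inv y ≡ x
    x*y*y⁻¹≡x = trans (R.*-assoc _ _ _) (trans (cong (x *_) (inverseʳ y≢0)) (R.*-identityʳ x))

  -- With inv 0# = 0# this is a bijection of the whole field, sending b to a.
  möbius : Carrier → Carrier → Carrier → Carrier → Carrier
  möbius a c b y = a + c * inv (y - b)

  möbius-at-pole : ∀ a c b → möbius a c b b ≡ a
  möbius-at-pole a c b = begin
    a + c * inv (b - b)   ≡⟨ cong (λ t → a + c * inv t) (R.-‿inverseʳ b) ⟩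
    a + c * inv 0#        ≡⟨ cong (λ t → a + c * t) inv-0 ⟩
    a + c * 0#            ≡⟨ cong (a +_) (R.zeroʳ c) ⟩
    a + 0#                ≡⟨ R.+-identityʳ a ⟩
    a                     ∎

  möbius-numerator : ∀ {s y} z → s * (y - 1#) ≡ 1# → z + (z - 1#) * s ≡ s * (z * y - 1#)
  möbius-numerator {s} {y} z s[y-1]≡1 = begin
    z + (z - 1#) * s                    ≡⟨ cong (λ u → u + (z - 1#) * s)
                                             (sym (trans (cong (z *_) s[y-1]≡1) (R.*-identityʳ z))) ⟩
    z * (s * (y - 1#)) + (z - 1#) * s   ≡⟨ solve 3 (λ z s y → z :* (s :* (y :- con (ℤ.+ 1))) :+ (z :- con (ℤ.+ 1)) :* s
                                                    := s :* (z :* y :- con (ℤ.+ 1))) refl z s y ⟩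
    s * (z * y - 1#)                    ∎

  möbius-numerator-1 : ∀ {s y} z → s * (y - 1#) ≡ 1# → z + (z - 1#) * s - 1# ≡ (z - 1#) * s * y
  möbius-numerator-1 {s} {y} z s[y-1]≡1 = begin
    z + (z - 1#) * s - 1#              ≡⟨ solve 2 (λ z s → z :+ (z :- con (ℤ.+ 1)) :* s :- con (ℤ.+ 1)
                                                   := (z :- con (ℤ.+ 1)) :* (con (ℤ.+ 1) :+ s)) refl z s ⟩
    (z - 1#) * (1# + s)                ≡⟨ cong (λ u → (z - 1#) * (u + s)) (sym s[y-1]≡1) ⟩
    (z - 1#) * (s * (y - 1#) + s)      ≡⟨ solve 3 (λ z s y → (z :- con (ℤ.+ 1)) :* (s :* (y :- con (ℤ.+ 1)) :+ s)
                                                   := (z :- con (ℤ.+ 1)) :* s :* y) refl z s y ⟩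
    (z - 1#) * s * y                   ∎

  möbius-inverse : ∀ {c} a b → c ≢ 0# → ∀ x → möbius a c b (möbius b c a x) ≡ x
  möbius-inverse {c} a b c≢0 x = begin
    a + c * inv ((b + c * inv (x - a)) - b)   ≡⟨ cong (λ t → a + c * inv t)
                                                   (solve 2 (λ b t → (b :+ t) :- b := t) refl b _) ⟩
    a + c * inv (c * inv (x - a))             ≡⟨ cong (λ t → a + c * t)
                                                   (trans (inv-distrib-* c _) (cong (inv c *_) (inv-involutive _))) ⟩
    a + c * (inv c * (x - a))                 ≡⟨ cong (a +_) (sym (R.*-assoc c (inv c) _)) ⟩
    a + (c * inv c) * (x - a)                 ≡⟨ cong (λ t → a + t * (x - a)) (inverseʳ c≢0) ⟩
    a + 1# * (x - a)                          ≡⟨ solve 2 (λ a x → a :+ con (ℤ.+ 1) :* (x :- a) := x) refl a x ⟩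
    x                                         ∎

module OddOrderField (F : FiniteField) (odd : ¬ (2 ∣ FiniteField.size F)) where

  open FiniteField F
  open FieldProperties F
  open IntegerCoefficientSolver isCommutativeRing
  open FieldSums F ℕ.+-0-isCommutativeMonoid
  private
    module R = IsCommutativeRing isCommutativeRing
    open ≡-Reasoning

    𝟙 : {P : Set} → Dec P → ℕ
    𝟙 d = if does d then 1 else 0

    count : {P : Carrier → Set} → (∀ x → Dec (P x)) → ℕ
    count P? = ∑ (λ x → 𝟙 (P? x))

    𝟙-complement : {P : Set} (d : Dec P) → 1 ≡ 𝟙 d ℕ.+ 𝟙 (¬? d)
    𝟙-complement (yes _) = refl
    𝟙-complement (no  _) = refl

    𝟙-⇔ : {P Q : Set} (d : Dec P) (d′ : Dec Q) → (P → Q) → (Q → P) → 𝟙 d ≡ 𝟙 d′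
    𝟙-⇔ d d′ P→Q Q→P = cong (if_then 1 else 0) (does-⇔ (mk⇔ P→Q Q→P) d d′)

    sumList-one : ∀ xs → sumList xs (λ _ → 1) ≡ length xs
    sumList-one []       = refl
    sumList-one (x ∷ xs) = cong suc (sumList-one xs)

    sumList≡0⇒≡0 : ∀ xs (f : Carrier → ℕ) → sumList xs f ≡ 0 → ∀ {x} → x ∈ xs → f x ≡ 0
    sumList≡0⇒≡0 (y ∷ xs) f ∑≡0 (here refl) = ℕ.m+n≡0⇒m≡0 (f y) ∑≡0
    sumList≡0⇒≡0 (y ∷ xs) f ∑≡0 (there x∈) = sumList≡0⇒≡0 xs f (ℕ.m+n≡0⇒n≡0 (f y) ∑≡0) x∈

  1+1≢0 : 1# + 1# ≢ 0#
  1+1≢0 1+1≡0 = odd (divides (count below?) size≡count*2)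
    where
    -- x ↦ x + 1 is a fixed-point-free involution; each orbit {x, x + 1} is
    -- counted once by comparing positions in the enumeration.
    rank : Carrier → ℕ
    rank x = toℕ (Any.index (complete x))

    rank-injective : ∀ {x y} → rank x ≡ rank y → x ≡ y
    rank-injective {x} {y} eq = trans (Any.lookup-index (complete x))
      (trans (cong (lookup elements) (Fin.toℕ-injective eq)) (sym (Any.lookup-index (complete y))))

    σ : Carrier → Carrier
    σ x = x + 1#

    σ-involutive : ∀ x → σ (σ x) ≡ x
    σ-involutive x = trans (R.+-assoc x 1# 1#) (trans (cong (x +_) 1+1≡0) (R.+-identityʳ x))

    σ-no-fixed-point : ∀ x → σ x ≢ x
    σ-no-fixed-point x σx≡x = 1≢0 (begin
      1#            ≡⟨ solve 2 (λ x o → o := (x :+ o) :- x) refl x 1# ⟩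
      σ x - x       ≡⟨ cong (_- x) σx≡x ⟩
      x - x         ≡⟨ R.-‿inverseʳ x ⟩
      0#            ∎)

    below? : ∀ x → Dec (rank x < rank (σ x))
    below? x = rank x <? rank (σ x)

    not-below : ∀ x → 𝟙 (¬? (below? x)) ≡ 𝟙 (below? (σ x))
    not-below x = 𝟙-⇔ (¬? (below? x)) (below? (σ x))
      (λ x≮σx → subst (λ t → rank (σ x) < rank t) (sym (σ-involutive x))
                  (ℕ.≤∧≢⇒< (ℕ.≮⇒≥ x≮σx) (λ eq → σ-no-fixed-point x (rank-injective eq))))
      (λ σx<σσx x<σx → ℕ.<-asym x<σx (subst (λ t → rank (σ x) < rank t) (σ-involutive x) σx<σσx))

    size≡count*2 : size ≡ count below? ℕ.* 2
    size≡count*2 = begin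
      size                                              ≡⟨ sym (sumList-one elements) ⟩
      ∑ (λ _ → 1)                                       ≡⟨ ∑-cong (λ x → 𝟙-complement (below? x)) ⟩
      ∑ (λ x → 𝟙 (below? x) ℕ.+ 𝟙 (¬? (below? x)))      ≡⟨ ∑-distrib _ _ ⟩
      count below? ℕ.+ ∑ (λ x → 𝟙 (¬? (below? x)))      ≡⟨ cong (count below? ℕ.+_) (∑-cong not-below) ⟩
      count below? ℕ.+ ∑ (λ x → 𝟙 (below? (σ x)))       ≡⟨ cong (count below? ℕ.+_)
                                                              (∑-reindex σ σ σ-involutive σ-involutive _) ⟩
      count below? ℕ.+ count below?                     ≡⟨ cong (count below? ℕ.+_) (sym (ℕ.+-identityʳ _)) ⟩
      2 ℕ.* count below?                                ≡⟨ ℕ.*-comm 2 (count below?) ⟩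
      count below? ℕ.* 2                                ∎

  x≢-x : ∀ {x} → x ≢ 0# → x ≢ - x
  x≢-x {x} x≢0 x≡-x = x≢0 (x*y≡0⇒y≡0 (begin
    (1# + 1#) * x   ≡⟨ solve 1 (λ x → (con (ℤ.+ 1) :+ con (ℤ.+ 1)) :* x := x :+ x) refl x ⟩
    x + x           ≡⟨ cong (x +_) x≡-x ⟩
    x - x           ≡⟨ R.-‿inverseʳ x ⟩
    0#              ∎) 1+1≢0)

  private
    nonzero? : ∀ x → Dec (x ≢ 0#)
    nonzero? x = ¬? (x ≟ 0#)

    nonzeroSquare? : ∀ x → Dec (x ≢ 0# × IsSquare x)
    nonzeroSquare? x = nonzero? x ×-dec isSquare? x

    nonzeroNonsquare? : ∀ x → Dec (x ≢ 0# × ¬ IsSquare x)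
    nonzeroNonsquare? x = nonzero? x ×-dec ¬? (isSquare? x)

    if-const : ∀ b → (if b then 0 else 0) ≡ 0
    if-const true  = refl
    if-const false = refl

    𝟙≡0⇒¬ : {P : Set} (d : Dec P) → 𝟙 d ≡ 0 → ¬ P
    𝟙≡0⇒¬ (no ¬p) _ = ¬p

    #nonzero≡#squares+#nonsquares : count nonzero? ≡ count nonzeroSquare? ℕ.+ count nonzeroNonsquare?
    #nonzero≡#squares+#nonsquares = trans (∑-cong split) (∑-distrib _ _)
      where
      split : ∀ y → 𝟙 (nonzero? y) ≡ 𝟙 (nonzeroSquare? y) ℕ.+ 𝟙 (nonzeroNonsquare? y)
      split y with y ≟ 0# | isSquare? y
      ... | yes _ | _     = refl
      ... | no  _ | yes _ = refl
      ... | no  _ | no  _ = refl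

    two-roots : ∀ {y} t → t * t ≡ y → t ≢ 0# → ∀ x →
                (if does (y ≟ (x * x)) then 1 else 0) ≡ 𝟙 (x ≟ t) ℕ.+ 𝟙 (x ≟ (- t))
    two-roots {y} t tt≡y t≢0 x with y ≟ (x * x) | x ≟ t | x ≟ (- t)
    ... | yes _    | yes x≡t | yes x≡-t = ⊥-elim (x≢-x t≢0 (trans (sym x≡t) x≡-t))
    ... | yes _    | yes _   | no  _    = refl
    ... | yes _    | no  _   | yes _    = refl
    ... | yes y≡xx | no x≢t  | no x≢-t with x*x≡y*y⇒x≡±y (trans (sym y≡xx) (sym tt≡y))
    ...   | inj₁ x≡t  = ⊥-elim (x≢t x≡t)
    ...   | inj₂ x≡-t = ⊥-elim (x≢-t x≡-t)
    two-roots t tt≡y t≢0 x | no y≢xx | yes refl | _        = ⊥-elim (y≢xx (sym tt≡y))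
    two-roots t tt≡y t≢0 x | no y≢xx | no _     | yes refl =
      ⊥-elim (y≢xx (trans (sym tt≡y) (solve 1 (λ t → t :* t := (:- t) :* (:- t)) refl t)))
    two-roots t tt≡y t≢0 x | no _    | no _     | no _     = refl

    #roots : ∀ y → ∑ (λ x → if does (y ≟ (x * x)) then 𝟙 (nonzero? y) else 0)
                   ≡ 𝟙 (nonzeroSquare? y) ℕ.+ 𝟙 (nonzeroSquare? y)
    #roots y with y ≟ 0#
    ... | yes _ = trans (∑-cong (λ x → if-const (does (y ≟ (x * x))))) ∑-zero
    ... | no y≢0 with isSquare? y
    ...   | no ¬sy = trans (∑-cong not-root) ∑-zero
      where
      not-root : ∀ x → (if does (y ≟ (x * x)) then 1 else 0) ≡ 0
      not-root x with y ≟ (x * x)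
      ... | yes y≡xx = ⊥-elim (¬sy (subst IsSquare (sym y≡xx) (square-isSquare x)))
      ... | no  _    = refl
    ...   | yes sy with Any.satisfied sy
    ...     | t , tt≡y = trans (∑-cong (two-roots t tt≡y t≢0))
                           (trans (∑-distrib _ _) (cong₂ ℕ._+_ (∑-pick t (λ _ → 1)) (∑-pick (- t) (λ _ → 1))))
      where
      t≢0 : t ≢ 0#
      t≢0 t≡0 = y≢0 (trans (sym tt≡y) (trans (cong (_* t) t≡0) (R.zeroˡ t)))

    #nonzero≡2#squares : count nonzero? ≡ count nonzeroSquare? ℕ.+ count nonzeroSquare?
    #nonzero≡2#squares = begin
      ∑ (λ x → 𝟙 (nonzero? x))                                        ≡⟨ ∑-cong nonzero-square ⟩
      ∑ (λ x → 𝟙 (nonzero? (x * x)))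
        ≡⟨ ∑-cong (λ x → sym (∑-pick (x * x) (λ y → 𝟙 (nonzero? y)))) ⟩
      ∑ (λ x → ∑ (λ y → if does (y ≟ (x * x)) then 𝟙 (nonzero? y) else 0)) ≡⟨ ∑-swap _ ⟩
      ∑ (λ y → ∑ (λ x → if does (y ≟ (x * x)) then 𝟙 (nonzero? y) else 0)) ≡⟨ ∑-cong #roots ⟩
      ∑ (λ y → 𝟙 (nonzeroSquare? y) ℕ.+ 𝟙 (nonzeroSquare? y))         ≡⟨ ∑-distrib _ _ ⟩
      count nonzeroSquare? ℕ.+ count nonzeroSquare?                   ∎
      where
      nonzero-square : ∀ x → 𝟙 (nonzero? x) ≡ 𝟙 (nonzero? (x * x))
      nonzero-square x = 𝟙-⇔ (nonzero? x) (nonzero? (x * x)) (λ x≢0 → *-≢0 x≢0 x≢0)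
        (λ xx≢0 x≡0 → xx≢0 (trans (cong (_* x) x≡0) (R.zeroˡ x)))

    #nonsquares≡#squares : count nonzeroNonsquare? ≡ count nonzeroSquare?
    #nonsquares≡#squares = ℕ.+-cancelˡ-≡ (count nonzeroSquare?) _ _
      (trans (sym #nonzero≡#squares+#nonsquares) #nonzero≡2#squares)

  -- Multiplication by a maps the nonzero squares into the nonsquares; as squaring is
  -- two-to-one there are equally many of both, so no nonsquare b has a b a nonsquare.
  nonsquare*nonsquare : ∀ {a b} → a ≢ 0# → ¬ IsSquare a → b ≢ 0# → ¬ IsSquare b → IsSquare (a * b)
  nonsquare*nonsquare {a} {b} a≢0 ¬sa b≢0 ¬sb with isSquare? (a * b)
  ... | yes sab = sab
  ... | no ¬sab = ⊥-elim (𝟙≡0⇒¬ (both? b) (sumList≡0⇒≡0 elements (λ y → 𝟙 (both? y)) #both≡0 (complete b))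
                                 (b≢0 , ¬sb , ¬sab))
    where
    both? : ∀ y → Dec (y ≢ 0# × ¬ IsSquare y × ¬ IsSquare (a * y))
    both? y = nonzero? y ×-dec (¬? (isSquare? y) ×-dec ¬? (isSquare? (a * y)))

    split : ∀ y → 𝟙 (nonzeroNonsquare? (a * y)) ≡ 𝟙 (nonzeroSquare? y) ℕ.+ 𝟙 (both? y)
    split y with y ≟ 0# | isSquare? y | (a * y) ≟ 0# | isSquare? (a * y)
    ... | yes _    | _     | yes _    | _      = refl
    ... | yes refl | _     | no ay≢0  | _      = ⊥-elim (ay≢0 (R.zeroʳ a))
    ... | no y≢0   | _     | yes ay≡0 | _      = ⊥-elim (*-≢0 a≢0 y≢0 ay≡0)
    ... | no y≢0   | yes sy | no _    | yes say = ⊥-elim (¬sa (isSquare-cancelʳ sy y≢0 say))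
    ... | no _     | yes _ | no _     | no _   = refl
    ... | no _     | no _  | no _     | yes _  = refl
    ... | no _     | no _  | no _     | no _   = refl

    #nonsquares≡#squares+#both : count nonzeroNonsquare? ≡ count nonzeroSquare? ℕ.+ count both?
    #nonsquares≡#squares+#both = begin
      count nonzeroNonsquare?                                    ≡⟨ sym (∑-reindex (a *_) (inv a *_) a⁻¹a a⁻¹a′ _) ⟩
      ∑ (λ y → 𝟙 (nonzeroNonsquare? (a * y)))                    ≡⟨ ∑-cong split ⟩
      ∑ (λ y → 𝟙 (nonzeroSquare? y) ℕ.+ 𝟙 (both? y))             ≡⟨ ∑-distrib _ _ ⟩
      count nonzeroSquare? ℕ.+ count both?                       ∎
      where
      a⁻¹a : ∀ x → inv a * (a * x) ≡ x
      a⁻¹a x = trans (sym (R.*-assoc _ _ _)) (trans (cong (_* x) (inverseˡ a≢0)) (R.*-identityˡ x))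
      a⁻¹a′ : ∀ x → a * (inv a * x) ≡ x
      a⁻¹a′ x = trans (sym (R.*-assoc _ _ _)) (trans (cong (_* x) (inverseʳ a≢0)) (R.*-identityˡ x))

    #both≡0 : count both? ≡ 0
    #both≡0 = ℕ.+-cancelˡ-≡ (count nonzeroSquare?) _ _
      (trans (sym #nonsquares≡#squares+#both) (trans #nonsquares≡#squares (sym (ℕ.+-identityʳ _))))

module CharacterProperties (F : FiniteField) (K : CharZeroField) where

  private
    module F = FiniteField F
    module K = CharZeroField K
    module FR = IsCommutativeRing F.isCommutativeRing
    module KR = IsCommutativeRing K.isCommutativeRing
    module FS = IntegerCoefficientSolver F.isCommutativeRing
    module KS = IntegerCoefficientSolver K.isCommutativeRing
    open ≡-Reasoning
  open FieldProperties F

  K-a*b≡0⇒b≡0 : ∀ {a b} → a K.* b ≡ K.0# → a ≢ K.0# → b ≡ K.0#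
  K-a*b≡0⇒b≡0 {a} {b} ab≡0 a≢0 with K.inverse a a≢0
  ... | a′ , aa′≡1 = begin
    b                 ≡⟨ sym (KR.*-identityˡ b) ⟩
    K.1# K.* b        ≡⟨ cong (K._* b) (sym (trans (KR.*-comm a′ a) aa′≡1)) ⟩
    (a′ K.* a) K.* b  ≡⟨ KR.*-assoc _ _ _ ⟩
    a′ K.* (a K.* b)  ≡⟨ cong (a′ K.*_) ab≡0 ⟩
    a′ K.* K.0#       ≡⟨ KR.zeroʳ _ ⟩
    K.0#              ∎

  K-a*a≡1⇒a≡-1 : ∀ {a} → a ≢ K.1# → a K.* a ≡ K.1# → a ≡ K.- K.1#
  K-a*a≡1⇒a≡-1 {a} a≢1 aa≡1 = begin
    a                          ≡⟨ KS.solve 1 (λ a → a KS.:= (a KS.:+ KS.con (ℤ.+ 1)) KS.:- KS.con (ℤ.+ 1)) refl a ⟩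
    (a K.+ K.1#) K.+ K.- K.1#  ≡⟨ cong (K._+ K.- K.1#) a+1≡0 ⟩
    K.0# K.+ K.- K.1#          ≡⟨ KR.+-identityˡ _ ⟩
    K.- K.1#                   ∎
    where
    a-1≢0 : a K.+ K.- K.1# ≢ K.0#
    a-1≢0 a-1≡0 = a≢1 (begin
      a                          ≡⟨ KS.solve 1 (λ a → a KS.:= (a KS.:- KS.con (ℤ.+ 1)) KS.:+ KS.con (ℤ.+ 1)) refl a ⟩
      (a K.+ K.- K.1#) K.+ K.1#  ≡⟨ cong (K._+ K.1#) a-1≡0 ⟩
      K.0# K.+ K.1#              ≡⟨ KR.+-identityˡ _ ⟩
      K.1#                       ∎)
    a+1≡0 : a K.+ K.1# ≡ K.0#
    a+1≡0 = K-a*b≡0⇒b≡0 (begin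
      (a K.+ K.- K.1#) K.* (a K.+ K.1#)  ≡⟨ KS.solve 1 (λ a → (a KS.:- KS.con (ℤ.+ 1)) KS.:* (a KS.:+ KS.con (ℤ.+ 1))
                                                           KS.:= a KS.:* a KS.:- KS.con (ℤ.+ 1)) refl a ⟩
      a K.* a K.+ K.- K.1#               ≡⟨ cong (K._+ K.- K.1#) aa≡1 ⟩
      K.1# K.+ K.- K.1#                  ≡⟨ KR.-‿inverseʳ K.1# ⟩
      K.0#                               ∎) a-1≢0

  εχ-≢0 : ∀ {x} → x ≢ F.0# → εχ F K x ≡ K.1#
  εχ-≢0 {x} x≢0 with x F.≟ F.0#
  ... | yes x≡0 = ⊥-elim (x≢0 x≡0)
  ... | no  _   = refl

  εχ-0 : εχ F K F.0# ≡ K.0#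
  εχ-0 with F.0# F.≟ F.0#
  ... | yes _   = refl
  ... | no 0≢0 = ⊥-elim (0≢0 refl)

  φ-0 : φ F K F.0# ≡ K.0#
  φ-0 with F.0# F.≟ F.0#
  ... | yes _   = refl
  ... | no 0≢0 = ⊥-elim (0≢0 refl)

  φ-square : ∀ {x} → x ≢ F.0# → IsSquare x → φ F K x ≡ K.1#
  φ-square {x} x≢0 sx with x F.≟ F.0#
  ... | yes x≡0 = ⊥-elim (x≢0 x≡0)
  ... | no _ with isSquare? x
  ...   | yes _  = refl
  ...   | no ¬sx = ⊥-elim (¬sx sx)

  φ-nonsquare : ∀ {x} → x ≢ F.0# → ¬ IsSquare x → φ F K x ≡ K.- K.1#
  φ-nonsquare {x} x≢0 ¬sx with x F.≟ F.0#
  ... | yes x≡0 = ⊥-elim (x≢0 x≡0)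
  ... | no _ with isSquare? x
  ...   | yes sx = ⊥-elim (¬sx sx)
  ...   | no _   = refl

  module CharacterLemmas {χ : Char F K} (isχ : IsCharacter F K χ) where
    open IsCharacter isχ public

    inverse : ∀ {x} → x ≢ F.0# → χ x K.* χ (F.inv x) ≡ K.1#
    inverse {x} x≢0 = trans (sym (mult x (F.inv x))) (trans (cong χ (inverseʳ x≢0)) at-1)

    [-1]² : χ (F.- F.1#) K.* χ (F.- F.1#) ≡ K.1#
    [-1]² = trans (sym (mult _ _)) (trans (cong χ (FS.solve 0
      ((FS.:- FS.con (ℤ.+ 1)) FS.:* (FS.:- FS.con (ℤ.+ 1)) FS.:= FS.con (ℤ.+ 1)) refl)) at-1)

    neg : ∀ x → χ (F.- x) ≡ χ (F.- F.1#) K.* χ x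
    neg x = trans (cong χ (FS.solve 1 (λ x → FS.:- x FS.:= (FS.:- FS.con (ℤ.+ 1)) FS.:* x) refl x)) (mult _ _)

    neg-pair : ∀ x y → χ (F.- x) K.* χ (F.- y) ≡ χ x K.* χ y
    neg-pair x y = begin
      χ (F.- x) K.* χ (F.- y)                        ≡⟨ cong₂ K._*_ (neg x) (neg y) ⟩
      (χ (F.- F.1#) K.* χ x) K.* (χ (F.- F.1#) K.* χ y) ≡⟨ KS.solve 3 (λ s a b → (s KS.:* a) KS.:* (s KS.:* b)
                                                            KS.:= (s KS.:* s) KS.:* (a KS.:* b)) refl _ (χ x) (χ y) ⟩
      (χ (F.- F.1#) K.* χ (F.- F.1#)) K.* (χ x K.* χ y) ≡⟨ cong (K._* (χ x K.* χ y)) [-1]² ⟩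
      K.1# K.* (χ x K.* χ y)                         ≡⟨ KR.*-identityˡ _ ⟩
      χ x K.* χ y                                    ∎

    ^-homo : ∀ x n → χ (x F.^ n) ≡ χ x K.^ n
    ^-homo x zero    = at-1
    ^-homo x (suc n) = trans (mult x (x F.^ n)) (cong (χ x K.*_) (^-homo x n))

    ^χ-≢0 : ∀ {x} → x ≢ F.0# → ∀ n → (_^χ_ F K χ n) x ≡ χ x K.^ n
    ^χ-≢0 x≢0 zero    = εχ-≢0 x≢0
    ^χ-≢0 x≢0 (suc n) = cong (χ _ K.*_) (^χ-≢0 x≢0 n)

  bar-isCharacter : ∀ {χ} → IsCharacter F K χ → IsCharacter F K (bar F K χ)
  bar-isCharacter {χ} isχ = record
    { at-0 = trans (cong χ inv-0) at-0
    ; at-1 = trans (cong χ inv-1) at-1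
    ; mult = λ x y → trans (cong χ (inv-distrib-* x y)) (mult _ _)
    }
    where open IsCharacter isχ

  ·χ-isCharacter : ∀ {χ ψ} → IsCharacter F K χ → IsCharacter F K ψ → IsCharacter F K (_·χ_ F K χ ψ)
  ·χ-isCharacter isχ isψ = record
    { at-0 = trans (cong (K._* _) χ.at-0) (KR.zeroˡ _)
    ; at-1 = trans (cong₂ K._*_ χ.at-1 ψ.at-1) (KR.*-identityʳ _)
    ; mult = λ x y → trans (cong₂ K._*_ (χ.mult x y) (ψ.mult x y))
               (KS.solve 4 (λ a b c d → (a KS.:* b) KS.:* (c KS.:* d) KS.:= (a KS.:* c) KS.:* (b KS.:* d)) refl _ _ _ _)
    }
    where
    module χ = IsCharacter isχ
    module ψ = IsCharacter isψ

  module QuadraticCharacter (odd : ¬ (2 ∣ F.size)) where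
    open OddOrderField F odd using (nonsquare*nonsquare)

    φ-* : ∀ x y → φ F K (x F.* y) ≡ φ F K x K.* φ F K y
    φ-* x y = by-cases (x F.≟ F.0#) (y F.≟ F.0#) (isSquare? x) (isSquare? y)
      where
      from-values : ∀ {a b c} → φ F K (x F.* y) ≡ a → φ F K x ≡ b → φ F K y ≡ c → a ≡ b K.* c →
                    φ F K (x F.* y) ≡ φ F K x K.* φ F K y
      from-values refl refl refl a≡bc = a≡bc

      -1*-1 : K.1# ≡ K.- K.1# K.* K.- K.1#
      -1*-1 = KS.solve 0 (KS.con (ℤ.+ 1) KS.:= (KS.:- KS.con (ℤ.+ 1)) KS.:* (KS.:- KS.con (ℤ.+ 1))) refl

      by-cases : Dec (x ≡ F.0#) → Dec (y ≡ F.0#) → Dec (IsSquare x) → Dec (IsSquare y) →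
                 φ F K (x F.* y) ≡ φ F K x K.* φ F K y
      by-cases (yes refl) _ _ _ = from-values (trans (cong (φ F K) (FR.zeroˡ y)) φ-0) φ-0 refl (sym (KR.zeroˡ _))
      by-cases (no _) (yes refl) _ _ = from-values (trans (cong (φ F K) (FR.zeroʳ x)) φ-0) refl φ-0 (sym (KR.zeroʳ _))
      by-cases (no x≢0) (no y≢0) (yes sx) (yes sy) =
        from-values (φ-square xy≢0 (isSquare-* sx sy)) (φ-square x≢0 sx) (φ-square y≢0 sy) (sym (KR.*-identityʳ _))
        where xy≢0 = *-≢0 x≢0 y≢0
      by-cases (no x≢0) (no y≢0) (yes sx) (no ¬sy) =
        from-values (φ-nonsquare xy≢0 (λ sxy → ¬sy (isSquare-cancelʳ sx x≢0 (subst IsSquare (FR.*-comm x y) sxy))))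
                    (φ-square x≢0 sx) (φ-nonsquare y≢0 ¬sy) (sym (KR.*-identityˡ _))
        where xy≢0 = *-≢0 x≢0 y≢0
      by-cases (no x≢0) (no y≢0) (no ¬sx) (yes sy) =
        from-values (φ-nonsquare xy≢0 (λ sxy → ¬sx (isSquare-cancelʳ sy y≢0 sxy)))
                    (φ-nonsquare x≢0 ¬sx) (φ-square y≢0 sy) (sym (KR.*-identityʳ _))
        where xy≢0 = *-≢0 x≢0 y≢0
      by-cases (no x≢0) (no y≢0) (no ¬sx) (no ¬sy) =
        from-values (φ-square xy≢0 (nonsquare*nonsquare x≢0 ¬sx y≢0 ¬sy))
                    (φ-nonsquare x≢0 ¬sx) (φ-nonsquare y≢0 ¬sy) -1*-1
        where xy≢0 = *-≢0 x≢0 y≢0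

    φ-isCharacter : IsCharacter F K (φ F K)
    φ-isCharacter = record
      { at-0 = φ-0
      ; at-1 = φ-square 1≢0 (subst IsSquare (FR.*-identityˡ F.1#) (square-isSquare F.1#))
      ; mult = φ-* }

    φ²≡1 : ∀ {x} → x ≢ F.0# → φ F K x K.* φ F K x ≡ K.1#
    φ²≡1 {x} x≢0 = trans (sym (φ-* x x)) (φ-square (*-≢0 x≢0 x≢0) (square-isSquare x))

    φ-inv : ∀ x → φ F K (F.inv x) ≡ φ F K x
    φ-inv = by-cases-at F.0# (cong (φ F K) inv-0) at-≢0
      where
      open CharacterLemmas φ-isCharacter using (inverse)
      at-≢0 : ∀ {x} → x ≢ F.0# → φ F K (F.inv x) ≡ φ F K x
      at-≢0 {x} x≢0 = begin
        φ F K (F.inv x)                                   ≡⟨ sym (KR.*-identityʳ _) ⟩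
        φ F K (F.inv x) K.* K.1#                          ≡⟨ cong (φ F K (F.inv x) K.*_) (sym (φ²≡1 x≢0)) ⟩
        φ F K (F.inv x) K.* (φ F K x K.* φ F K x)         ≡⟨ sym (KR.*-assoc _ _ _) ⟩
        (φ F K (F.inv x) K.* φ F K x) K.* φ F K x         ≡⟨ cong (K._* φ F K x) (trans (KR.*-comm _ _) (inverse x≢0)) ⟩
        K.1# K.* φ F K x                                  ≡⟨ KR.*-identityˡ _ ⟩
        φ F K x                                           ∎

    order-two≡φ : (u : F.Carrier → K.Carrier) → (∀ x y → u (x F.* y) ≡ u x K.* u y) →
                  (∀ {x} → x ≢ F.0# → u x K.* u x ≡ K.1#) → ¬ (∀ {x} → x ≢ F.0# → u x ≡ K.1#) →
                  ∀ {x} → x ≢ F.0# → u x ≡ φ F K x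
    order-two≡φ u u-* u²≡1 u≢1 {x} x≢0 = by-cases (isSquare? x)
      where
      u-square : ∀ {t} → t ≢ F.0# → IsSquare t → u t ≡ K.1#
      u-square t≢0 st with Any.satisfied st
      ... | s , refl = trans (u-* s s) (u²≡1 (λ s≡0 → t≢0 (trans (cong (F._* s) s≡0) (FR.zeroˡ s))))

      -- every nonsquare is b times a square, so u b = 1 would make u trivial
      u-nonsquare : ∀ {b} → b ≢ F.0# → ¬ IsSquare b → u b ≢ K.1#
      u-nonsquare {b} b≢0 ¬sb ub≡1 = u≢1 u≡1
        where
        u≡1 : ∀ {y} → y ≢ F.0# → u y ≡ K.1#
        u≡1 {y} y≢0 with isSquare? y
        ... | yes sy  = u-square y≢0 sy
        ... | no  ¬sy = begin
          u y                          ≡⟨ cong u (sym b*b⁻¹y≡y) ⟩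
          u (b F.* (F.inv b F.* y))    ≡⟨ u-* b _ ⟩
          u b K.* u (F.inv b F.* y)    ≡⟨ cong₂ K._*_ ub≡1 (u-square (*-≢0 (inv-≢0 b≢0) y≢0)
                                            (nonsquare*nonsquare (inv-≢0 b≢0) ¬sb⁻¹ y≢0 ¬sy)) ⟩
          K.1# K.* K.1#                ≡⟨ KR.*-identityˡ _ ⟩
          K.1#                         ∎
          where
          b*b⁻¹y≡y : b F.* (F.inv b F.* y) ≡ y
          b*b⁻¹y≡y = trans (sym (FR.*-assoc _ _ _)) (trans (cong (F._* y) (inverseʳ b≢0)) (FR.*-identityˡ y))
          ¬sb⁻¹ : ¬ IsSquare (F.inv b)
          ¬sb⁻¹ sb⁻¹ = ¬sb (subst IsSquare (inv-involutive b) (isSquare-inv sb⁻¹))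

      by-cases : Dec (IsSquare x) → u x ≡ φ F K x
      by-cases (yes sx)  = trans (u-square x≢0 sx) (sym (φ-square x≢0 sx))
      by-cases (no ¬sx) = trans (K-a*a≡1⇒a≡-1 (u-nonsquare x≢0 ¬sx) (u²≡1 x≢0)) (sym (φ-nonsquare x≢0 ¬sx))

open import Data.Nat using (_+_; _*_)

n*2≡n+n : ∀ n → n * 2 ≡ n + n
n*2≡n+n n = trans (ℕ.*-comm n 2) (cong (n +_) (ℕ.+-identityʳ n))

even-or-odd : ∀ n → Σ ℕ (λ k → n ≡ k + k) ⊎ Σ ℕ (λ k → n ≡ suc (k + k))
even-or-odd zero    = inj₁ (0 , refl)
even-or-odd (suc n) with even-or-odd n
... | inj₁ (k , n≡k+k)   = inj₂ (k , cong suc n≡k+k)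
... | inj₂ (k , n≡1+k+k) = inj₁ (suc k , cong suc (trans n≡1+k+k (sym (ℕ.+-suc k k))))

⌊n+n/2⌋≡n : ∀ n → ⌊ n + n /2⌋ ≡ n
⌊n+n/2⌋≡n zero    = refl
⌊n+n/2⌋≡n (suc n) = trans (cong (λ m → ⌊ suc m /2⌋) (ℕ.+-suc n n)) (cong suc (⌊n+n/2⌋≡n n))

module Hypergeometric (F : FiniteField) (K : CharZeroField) (odd : ¬ (2 ∣ FiniteField.size F)) where

  private
    module F = FiniteField F
    module K = CharZeroField K
    module FR = IsCommutativeRing F.isCommutativeRing
    module KR = IsCommutativeRing K.isCommutativeRing
    module FS = IntegerCoefficientSolver F.isCommutativeRing
    module KS = IntegerCoefficientSolver K.isCommutativeRing
    open ≡-Reasoning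
  open FieldProperties F
  open FieldSums F (IsCommutativeRing.+-isCommutativeMonoid K.isCommutativeRing)
  open CharacterProperties F K
  open QuadraticCharacter odd

  *-distribˡ-∑ : ∀ a f → ∑ (λ y → a K.* f y) ≡ a K.* ∑ f
  *-distribˡ-∑ a f = go F.elements
    where
    go : ∀ xs → sumList xs (λ y → a K.* f y) ≡ a K.* sumList xs f
    go []       = sym (KR.zeroʳ a)
    go (x ∷ xs) = trans (cong (a K.* f x K.+_) (go xs)) (sym (KR.distribˡ a _ _))

  ^-distrib-* : ∀ a b n → (a K.* b) K.^ n ≡ (a K.^ n) K.* (b K.^ n)
  ^-distrib-* a b zero    = sym (KR.*-identityʳ K.1#)
  ^-distrib-* a b (suc n) = trans (cong (a K.* b K.*_) (^-distrib-* a b n))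
    (KS.solve 4 (λ a b c d → (a KS.:* b) KS.:* (c KS.:* d) KS.:= (a KS.:* c) KS.:* (b KS.:* d)) refl a b _ _)

  ^-homo-+ : ∀ a m n → a K.^ (m + n) ≡ (a K.^ m) K.* (a K.^ n)
  ^-homo-+ a zero    n = sym (KR.*-identityˡ _)
  ^-homo-+ a (suc m) n = trans (cong (a K.*_) (^-homo-+ a m n)) (sym (KR.*-assoc _ _ _))

  a*a≡1⇒a^[m+m]≡1 : ∀ {a} → a K.* a ≡ K.1# → ∀ m → a K.^ (m + m) ≡ K.1#
  a*a≡1⇒a^[m+m]≡1 aa≡1 zero    = refl
  a*a≡1⇒a^[m+m]≡1 {a} aa≡1 (suc m) = begin
    a K.* a K.^ (m + suc m)         ≡⟨ cong (λ n → a K.* a K.^ n) (ℕ.+-suc m m) ⟩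
    a K.* (a K.* a K.^ (m + m))     ≡⟨ sym (KR.*-assoc _ _ _) ⟩
    (a K.* a) K.* a K.^ (m + m)     ≡⟨ cong₂ K._*_ aa≡1 (a*a≡1⇒a^[m+m]≡1 aa≡1 m) ⟩
    K.1# K.* K.1#                   ≡⟨ KR.*-identityʳ _ ⟩
    K.1#                            ∎

  module _ {η : Char F K} (isη : IsCharacter F K η) where

    private module η = CharacterLemmas isη

    ψ : Char F K
    ψ = _·χ_ F K (φ F K) (bar F K η)

    ψ-isCharacter : IsCharacter F K ψ
    ψ-isCharacter = ·χ-isCharacter φ-isCharacter (bar-isCharacter isη)

    private module ψ = CharacterLemmas ψ-isCharacter

    ψ-inv : ∀ x → ψ (F.inv x) ≡ φ F K x K.* η x
    ψ-inv x = cong₂ K._*_ (φ-inv x) (cong η (inv-involutive x))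

    eulerTerm : F.Carrier → F.Carrier → K.Carrier
    eulerTerm z y = η y K.* ψ (F.1# F.- y) K.* ψ (F.1# F.- z F.* y)

    eulerIntegral : F.Carrier → K.Carrier
    eulerIntegral z = ∑ (eulerTerm z)

    ₂F₁≡eulerIntegral : ∀ {z} → z ≢ F.0# →
      ₂F₁ F K (_·χ_ F K (φ F K) η) η (φ F K) z
        ≡ (_·χ_ F K (φ F K) η (F.- F.1#) K.* q⁻¹ F K) K.* eulerIntegral z
    ₂F₁≡eulerIntegral {z} z≢0 = begin
      εχ F K z K.* (η m1 K.* φ F K m1 K.* q⁻¹ F K) K.* ∑ integrand
        ≡⟨ cong₂ (λ e I → e K.* (η m1 K.* φ F K m1 K.* q⁻¹ F K) K.* I) (εχ-≢0 z≢0) (∑-cong bar-φη≡ψ) ⟩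
      K.1# K.* (η m1 K.* φ F K m1 K.* q⁻¹ F K) K.* eulerIntegral z
        ≡⟨ KS.solve 4 (λ a b q I → KS.con (ℤ.+ 1) KS.:* (a KS.:* b KS.:* q) KS.:* I KS.:= (b KS.:* a KS.:* q) KS.:* I)
                      refl (η m1) (φ F K m1) (q⁻¹ F K) (eulerIntegral z) ⟩
      (φ F K m1 K.* η m1 K.* q⁻¹ F K) K.* eulerIntegral z ∎
      where
      m1 = F.- F.1#
      integrand : F.Carrier → K.Carrier
      integrand y = η y K.* ψ (F.1# F.- y) K.* bar F K (_·χ_ F K (φ F K) η) (F.1# F.- z F.* y)
      bar-φη≡ψ : ∀ y → integrand y ≡ eulerTerm z y
      bar-φη≡ψ y = cong (λ p → η y K.* ψ (F.1# F.- y) K.* (p K.* η (F.inv (F.1# F.- z F.* y)))) (φ-inv _)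

    eulerTerm-at-0 : ∀ z → eulerTerm z F.0# ≡ K.0#
    eulerTerm-at-0 z = trans (cong (λ t → t K.* ψ (F.1# F.- F.0#) K.* ψ (F.1# F.- z F.* F.0#)) η.at-0)
                             (trans (cong (K._* ψ (F.1# F.- z F.* F.0#)) (KR.zeroˡ _)) (KR.zeroˡ _))

    eulerTerm-at-1 : ∀ z → eulerTerm z F.1# ≡ K.0#
    eulerTerm-at-1 z = trans (cong (λ t → η F.1# K.* t K.* ψ (F.1# F.- z F.* F.1#))
                                   (trans (cong ψ (FR.-‿inverseʳ F.1#)) ψ.at-0))
                             (trans (cong (K._* ψ (F.1# F.- z F.* F.1#)) (KR.zeroʳ _)) (KR.zeroˡ _))

    ψ[y⁻¹]^[k+k+2]≡η : ∀ k → (∀ {y} → y ≢ F.0# → η y K.^ suc (k + k) ≡ K.1#) →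
                        ∀ {y} → y ≢ F.0# → ψ (F.inv y) K.^ suc (suc (k + k)) ≡ η y
    ψ[y⁻¹]^[k+k+2]≡η k η^N≡1 {y} y≢0 = begin
      ψ (F.inv y) K.^ suc (suc (k + k))                        ≡⟨ cong (K._^ suc (suc (k + k))) (ψ-inv y) ⟩
      (φ F K y K.* η y) K.^ suc (suc (k + k))                  ≡⟨ ^-distrib-* _ _ (suc (suc (k + k))) ⟩
      φ F K y K.^ suc (suc (k + k)) K.* η y K.^ suc (suc (k + k))
        ≡⟨ cong₂ K._*_ (trans (cong (φ F K y K.^_) (cong suc (sym (ℕ.+-suc k k))))
                              (a*a≡1⇒a^[m+m]≡1 (φ²≡1 y≢0) (suc k)))
                       (cong (η y K.*_) (η^N≡1 y≢0)) ⟩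
      K.1# K.* (η y K.* K.1#)                                  ≡⟨ trans (KR.*-identityˡ _) (KR.*-identityʳ _) ⟩
      η y                                                      ∎

    oddTerm : ℕ → F.Carrier → F.Carrier → K.Carrier
    oddTerm k z x = ψ ((x F.^ (k + k)) F.* (x F.- F.1#) F.* (x F.- z))

    oddTerm-at-inverse : ∀ k → 0 < k → (∀ {y} → y ≢ F.0# → η y K.^ suc (k + k) ≡ K.1#) →
                         ∀ z y → oddTerm k z (F.inv y) ≡ eulerTerm z y
    oddTerm-at-inverse k@(suc _) _ η^N≡1 z = by-cases-at F.0# at-0 at-≢0
      where
      at-0 : oddTerm k z (F.inv F.0#) ≡ eulerTerm z F.0#
      at-0 = trans (cong ψ (trans (cong (λ x → (x F.^ (k + k)) F.* (x F.- F.1#) F.* (x F.- z)) inv-0)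
                              (trans (cong (λ t → t F.* _ F.* (F.0# F.- z)) (FR.zeroˡ _))
                                (trans (cong (F._* (F.0# F.- z)) (FR.zeroˡ _)) (FR.zeroˡ _)))))
                   (trans ψ.at-0 (sym (eulerTerm-at-0 z)))

      at-≢0 : ∀ {y} → y ≢ F.0# → oddTerm k z (F.inv y) ≡ eulerTerm z y
      at-≢0 {y} y≢0 = begin
        ψ ((x F.^ (k + k)) F.* (x F.- F.1#) F.* (x F.- z))
          ≡⟨ trans (ψ.mult _ _) (cong (K._* ψ (x F.- z)) (ψ.mult _ _)) ⟩
        ψ (x F.^ (k + k)) K.* ψ (x F.- F.1#) K.* ψ (x F.- z)
          ≡⟨ cong₂ (λ a b → ψ (x F.^ (k + k)) K.* ψ a K.* ψ b) x-1≡ x-z≡ ⟩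
        ψ (x F.^ (k + k)) K.* ψ ((F.1# F.- y) F.* x) K.* ψ ((F.1# F.- z F.* y) F.* x)
          ≡⟨ cong₂ (λ a b → ψ (x F.^ (k + k)) K.* a K.* b) (ψ.mult _ _) (ψ.mult _ _) ⟩
        ψ (x F.^ (k + k)) K.* (A K.* w) K.* (B K.* w)
          ≡⟨ cong (λ p → p K.* (A K.* w) K.* (B K.* w)) (ψ.^-homo x (k + k)) ⟩
        w K.^ (k + k) K.* (A K.* w) K.* (B K.* w)
          ≡⟨ KS.solve 4 (λ p w A B → p KS.:* (A KS.:* w) KS.:* (B KS.:* w) KS.:= w KS.:* (w KS.:* p) KS.:* A KS.:* B)
                        refl (w K.^ (k + k)) w A B ⟩
        w K.^ suc (suc (k + k)) K.* A K.* B
          ≡⟨ cong (λ p → p K.* A K.* B) (ψ[y⁻¹]^[k+k+2]≡η k η^N≡1 y≢0) ⟩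
        η y K.* A K.* B ∎
        where
        x = F.inv y
        w = ψ x
        A = ψ (F.1# F.- y)
        B = ψ (F.1# F.- z F.* y)
        yx≡1 : y F.* x ≡ F.1#
        yx≡1 = inverseʳ y≢0
        x-1≡ : x F.- F.1# ≡ (F.1# F.- y) F.* x
        x-1≡ = trans (cong (λ t → x F.- t) (sym yx≡1))
          (FS.solve 2 (λ x y → x FS.:- y FS.:* x FS.:= (FS.con (ℤ.+ 1) FS.:- y) FS.:* x) refl x y)
        x-z≡ : x F.- z ≡ (F.1# F.- z F.* y) F.* x
        x-z≡ = trans (cong (λ t → x F.- t) (sym (trans (cong (z F.*_) yx≡1) (FR.*-identityʳ z))))
          (FS.solve 3 (λ x y z → x FS.:- z FS.:* (y FS.:* x) FS.:= (FS.con (ℤ.+ 1) FS.:- z FS.:* y) FS.:* x) refl x y z)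

    -- Substitute x = 1/y; k > 0 makes the y = 0 term vanish on both sides.
    eulerIntegral≡S-odd : ∀ k → 0 < k → (∀ {y} → y ≢ F.0# → η y K.^ suc (k + k) ≡ K.1#) →
                          ∀ z → eulerIntegral z ≡ S F K (2 * suc (k + k)) ψ z
    eulerIntegral≡S-odd k k>0 η^N≡1 z = begin
      eulerIntegral z                    ≡⟨ ∑-cong (λ y → sym (oddTerm-at-inverse k k>0 η^N≡1 z y)) ⟩
      ∑ (λ y → oddTerm k z (F.inv y))    ≡⟨ ∑-reindex F.inv F.inv inv-involutive inv-involutive (oddTerm k z) ⟩
      ∑ (oddTerm k z)                    ≡⟨ ∑-cong (λ x → cong (λ e → ψ ((x F.^ e) F.* (x F.- F.1#) F.* (x F.- z)))
                                                               (sym exponent)) ⟩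
      S F K (2 * suc (k + k)) ψ z        ∎
      where
      exponent : ⌊ 2 * suc (k + k) /2⌋ ∸ 1 ≡ k + k
      exponent = trans (cong (λ m → ⌊ suc (k + k) + m /2⌋ ∸ 1) (ℕ.+-identityʳ (suc (k + k))))
                       (cong (_∸ 1) (⌊n+n/2⌋≡n (suc (k + k))))

    η^m≡ψ : ∀ m → 0 < m → (∀ {x} → x ≢ F.0# → η x K.^ suc m ≡ φ F K x) → ∀ x → η x K.^ m ≡ ψ x
    η^m≡ψ m@(suc j) _ η^[m+1]≡φ = by-cases-at F.0# at-0 at-≢0
      where
      at-0 : η F.0# K.^ m ≡ ψ F.0#
      at-0 = trans (cong (K._* η F.0# K.^ j) η.at-0) (trans (KR.zeroˡ _) (sym ψ.at-0))
      at-≢0 : ∀ {x} → x ≢ F.0# → η x K.^ m ≡ ψ x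
      at-≢0 {x} x≢0 = begin
        η x K.^ m                                    ≡⟨ sym (KR.*-identityʳ _) ⟩
        η x K.^ m K.* K.1#                           ≡⟨ cong (η x K.^ m K.*_) (sym (η.inverse x≢0)) ⟩
        η x K.^ m K.* (η x K.* η (F.inv x))          ≡⟨ KS.solve 3 (λ p a b → p KS.:* (a KS.:* b) KS.:= (a KS.:* p) KS.:* b)
                                                                   refl (η x K.^ m) (η x) (η (F.inv x)) ⟩
        η x K.^ suc m K.* η (F.inv x)                ≡⟨ cong (K._* η (F.inv x)) (η^[m+1]≡φ x≢0) ⟩
        ψ x                                          ∎

    ψ[t⁻¹]*η[t⁻¹]²≡ψ : ∀ {t} → t ≢ F.0# → ψ (F.inv t) K.* (η (F.inv t) K.* η (F.inv t)) ≡ ψ t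
    ψ[t⁻¹]*η[t⁻¹]²≡ψ {t} t≢0 = begin
      ψ s K.* (η s K.* η s)                    ≡⟨ cong (K._* (η s K.* η s)) (ψ-inv t) ⟩
      φ F K t K.* η t K.* (η s K.* η s)        ≡⟨ KS.solve 3 (λ f a b → f KS.:* a KS.:* (b KS.:* b)
                                                                  KS.:= (a KS.:* b) KS.:* (f KS.:* b))
                                                             refl (φ F K t) (η t) (η s) ⟩
      (η t K.* η s) K.* (φ F K t K.* η s)      ≡⟨ cong (K._* (φ F K t K.* η s)) (η.inverse t≢0) ⟩
      K.1# K.* ψ t                             ≡⟨ KR.*-identityˡ _ ⟩
      ψ t                                      ∎
      where s = F.inv t

    evenTerm : F.Carrier → F.Carrier → K.Carrier
    evenTerm z x = ψ x K.* η (x F.- F.1#) K.* η (x F.- z)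

    evenTerm-at-möbius : ∀ {z} → z ≢ F.1# → ∀ y →
      evenTerm z (möbius z (z F.- F.1#) F.1# y) ≡ η (z F.- F.1#) K.* η (z F.- F.1#) K.* eulerTerm z y
    evenTerm-at-möbius {z} z≢1 = by-cases-at F.1# at-1 at-≢1
      where
      c = z F.- F.1#

      at-1 : evenTerm z (möbius z c F.1# F.1#) ≡ η c K.* η c K.* eulerTerm z F.1#
      at-1 = begin
        evenTerm z (möbius z c F.1# F.1#)      ≡⟨ cong (evenTerm z) (möbius-at-pole z c F.1#) ⟩
        ψ z K.* η c K.* η (z F.- z)            ≡⟨ cong (ψ z K.* η c K.*_) (trans (cong η (FR.-‿inverseʳ z)) η.at-0) ⟩
        ψ z K.* η c K.* K.0#                   ≡⟨ KR.zeroʳ _ ⟩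
        K.0#                                   ≡⟨ sym (trans (cong (η c K.* η c K.*_) (eulerTerm-at-1 z)) (KR.zeroʳ _)) ⟩
        η c K.* η c K.* eulerTerm z F.1#       ∎

      at-≢1 : ∀ {y} → y ≢ F.1# → evenTerm z (möbius z c F.1# y) ≡ η c K.* η c K.* eulerTerm z y
      at-≢1 {y} y≢1 = begin
        ψ x K.* η (x F.- F.1#) K.* η (x F.- z)
          ≡⟨ cong₃ (cong ψ (möbius-numerator z st≡1)) (cong η (möbius-numerator-1 z st≡1))
                   (cong η (FS.solve 3 (λ z c s → z FS.:+ c FS.:* s FS.:- z FS.:= c FS.:* s) refl z c s)) ⟩
        ψ (s F.* (z F.* y F.- F.1#)) K.* η (c F.* s F.* y) K.* η (c F.* s)
          ≡⟨ cong₃ (ψ.mult _ _) (trans (η.mult _ _) (cong (K._* η y) (η.mult _ _))) (η.mult _ _) ⟩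
        ψ s K.* P K.* (η c K.* η s K.* η y) K.* (η c K.* η s)
          ≡⟨ KS.solve 5 (λ a P g e Y → a KS.:* P KS.:* (g KS.:* e KS.:* Y) KS.:* (g KS.:* e)
                          KS.:= g KS.:* g KS.:* (Y KS.:* (a KS.:* (e KS.:* e) KS.:* P)))
                        refl (ψ s) P (η c) (η s) (η y) ⟩
        η c K.* η c K.* (η y K.* (ψ s K.* (η s K.* η s) K.* P))
          ≡⟨ cong (λ a → η c K.* η c K.* (η y K.* (a K.* P))) (ψ[t⁻¹]*η[t⁻¹]²≡ψ (x≢y⇒x-y≢0 y≢1)) ⟩
        η c K.* η c K.* (η y K.* (ψ (y F.- F.1#) K.* P))
          ≡⟨ cong (λ a → η c K.* η c K.* a) (trans (cong (η y K.*_) flip-signs) (sym (KR.*-assoc _ _ _))) ⟩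
        η c K.* η c K.* eulerTerm z y ∎
        where
        s = F.inv (y F.- F.1#)
        st≡1 : s F.* (y F.- F.1#) ≡ F.1#
        st≡1 = inverseˡ (x≢y⇒x-y≢0 y≢1)
        x = möbius z c F.1# y
        P = ψ (z F.* y F.- F.1#)

        flip-signs : ψ (y F.- F.1#) K.* P ≡ ψ (F.1# F.- y) K.* ψ (F.1# F.- z F.* y)
        flip-signs = trans (cong₂ (λ a b → ψ a K.* ψ b) (a-1≡-[1-a] y) (a-1≡-[1-a] (z F.* y))) (ψ.neg-pair _ _)
          where
          a-1≡-[1-a] : ∀ a → a F.- F.1# ≡ F.- (F.1# F.- a)
          a-1≡-[1-a] = FS.solve 1 (λ a → a FS.:- FS.con (ℤ.+ 1) FS.:= FS.:- (FS.con (ℤ.+ 1) FS.:- a)) refl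

        cong₃ : ∀ {a a′ b b′ d d′} → a ≡ a′ → b ≡ b′ → d ≡ d′ → a K.* b K.* d ≡ a′ K.* b′ K.* d′
        cong₃ refl refl refl = refl

    -- Substitute x = z + (z - 1)/(y - 1); y = 1 corresponds to x = z, where both sides vanish.
    S≡η[z-1]²*eulerIntegral : ∀ m → 0 < m → (∀ {x} → x ≢ F.0# → η x K.^ suc m ≡ φ F K x) →
                              ∀ {z} → z ≢ F.1# →
                              S F K (suc m + suc m) η z ≡ (η (z F.- F.1#) K.* η (z F.- F.1#)) K.* eulerIntegral z
    S≡η[z-1]²*eulerIntegral m m>0 η^[m+1]≡φ {z} z≢1 = begin
      S F K (suc m + suc m) η z              ≡⟨ ∑-cong factor ⟩
      ∑ (evenTerm z)                         ≡⟨ sym (∑-reindex (möbius z c F.1#) (möbius F.1# c z)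
                                                     (möbius-inverse F.1# z c≢0) (möbius-inverse z F.1# c≢0) (evenTerm z)) ⟩
      ∑ (λ y → evenTerm z (möbius z c F.1# y)) ≡⟨ ∑-cong (evenTerm-at-möbius z≢1) ⟩
      ∑ (λ y → η c K.* η c K.* eulerTerm z y)  ≡⟨ *-distribˡ-∑ (η c K.* η c) (eulerTerm z) ⟩
      η c K.* η c K.* eulerIntegral z        ∎
      where
      c = z F.- F.1#
      c≢0 : c ≢ F.0#
      c≢0 = x≢y⇒x-y≢0 z≢1

      factor : ∀ x → η ((x F.^ (⌊ suc m + suc m /2⌋ ∸ 1)) F.* (x F.- F.1#) F.* (x F.- z)) ≡ evenTerm z x
      factor x = begin
        η ((x F.^ (⌊ suc m + suc m /2⌋ ∸ 1)) F.* (x F.- F.1#) F.* (x F.- z))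
          ≡⟨ cong (λ e → η ((x F.^ e) F.* (x F.- F.1#) F.* (x F.- z))) (cong (_∸ 1) (⌊n+n/2⌋≡n (suc m))) ⟩
        η ((x F.^ m) F.* (x F.- F.1#) F.* (x F.- z))
          ≡⟨ trans (η.mult _ _) (cong (K._* η (x F.- z)) (η.mult _ _)) ⟩
        η (x F.^ m) K.* η (x F.- F.1#) K.* η (x F.- z)
          ≡⟨ cong (λ a → a K.* η (x F.- F.1#) K.* η (x F.- z)) (trans (η.^-homo x m) (η^m≡ψ m m>0 η^[m+1]≡φ x)) ⟩
        evenTerm z x ∎

    eulerIntegral≡S-even : ∀ m → 0 < m → (∀ {x} → x ≢ F.0# → η x K.^ suc m ≡ φ F K x) →
                           ∀ {z} → z ≢ F.1# →
                           eulerIntegral z ≡ (bar F K η (F.1# F.- z) K.^ 2) K.* S F K (suc m + suc m) η z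
    eulerIntegral≡S-even m m>0 η^[m+1]≡φ {z} z≢1 = sym (begin
      w K.^ 2 K.* S F K (suc m + suc m) η z        ≡⟨ cong (w K.^ 2 K.*_) (S≡η[z-1]²*eulerIntegral m m>0 η^[m+1]≡φ z≢1) ⟩
      w K.^ 2 K.* (η c K.* η c K.* eulerIntegral z) ≡⟨ sym (KR.*-assoc _ _ _) ⟩
      w K.^ 2 K.* (η c K.* η c) K.* eulerIntegral z ≡⟨ cong (K._* eulerIntegral z) w²*η[c]²≡1 ⟩
      K.1# K.* eulerIntegral z                      ≡⟨ KR.*-identityˡ _ ⟩
      eulerIntegral z                               ∎)
      where
      c = z F.- F.1#
      v = η (F.1# F.- z)
      w = bar F K η (F.1# F.- z)
      n = η (F.- F.1#)
      η[c]≡n*v : η c ≡ n K.* v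
      η[c]≡n*v = trans (cong η (FS.solve 1 (λ z → z FS.:- FS.con (ℤ.+ 1) FS.:= FS.:- (FS.con (ℤ.+ 1) FS.:- z)) refl z))
                       (η.neg (F.1# F.- z))
      w²*η[c]²≡1 : w K.^ 2 K.* (η c K.* η c) ≡ K.1#
      w²*η[c]²≡1 = begin
        w K.* (w K.* K.1#) K.* (η c K.* η c)               ≡⟨ cong (λ a → w K.* (w K.* K.1#) K.* (a K.* a)) η[c]≡n*v ⟩
        w K.* (w K.* K.1#) K.* (n K.* v K.* (n K.* v))
          ≡⟨ KS.solve 3 (λ w n v → w KS.:* (w KS.:* KS.con (ℤ.+ 1)) KS.:* (n KS.:* v KS.:* (n KS.:* v))
                                   KS.:= v KS.:* w KS.:* (v KS.:* w) KS.:* (n KS.:* n)) refl w n v ⟩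
        v K.* w K.* (v K.* w) K.* (n K.* n)
          ≡⟨ cong₂ (λ a b → a K.* a K.* b) (η.inverse (x≢y⇒x-y≢0 (λ 1≡z → z≢1 (sym 1≡z)))) η.[-1]² ⟩
        K.1# K.* K.1# K.* K.1#                             ≡⟨ trans (KR.*-identityʳ _) (KR.*-identityʳ _) ⟩
        K.1#                                               ∎

    ^order≡1 : ∀ {N} → HasOrder F K η N → ∀ {y} → y ≢ F.0# → η y K.^ N ≡ K.1#
    ^order≡1 {N} (_ , η^N≡ε , _) {y} y≢0 = trans (sym (η.^χ-≢0 y≢0 N)) (trans (η^N≡ε y) (εχ-≢0 y≢0))

    η^[N/2]≡φ : ∀ {h} → HasOrder F K η (h + h) → 0 < h → ∀ {x} → x ≢ F.0# → η x K.^ h ≡ φ F K x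
    η^[N/2]≡φ {h@(suc j)} ord@(_ , _ , minimal) h>0 = order-two≡φ (λ x → η x K.^ h) u-* u²≡1 u≢1
      where
      u-* : ∀ x y → η (x F.* y) K.^ h ≡ η x K.^ h K.* η y K.^ h
      u-* x y = trans (cong (K._^ h) (η.mult x y)) (^-distrib-* _ _ h)
      u²≡1 : ∀ {x} → x ≢ F.0# → η x K.^ h K.* η x K.^ h ≡ K.1#
      u²≡1 {x} x≢0 = trans (sym (^-homo-+ (η x) h h)) (^order≡1 ord x≢0)
      u≢1 : ¬ (∀ {x} → x ≢ F.0# → η x K.^ h ≡ K.1#)
      u≢1 u≡1 = minimal h h>0 (ℕ.m<m+n h h>0) (by-cases-at F.0# at-0 at-≢0)
        where
        at-0 : (_^χ_ F K η h) F.0# ≡ εχ F K F.0#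
        at-0 = trans (cong (K._* (_^χ_ F K η j) F.0#) η.at-0) (trans (KR.zeroˡ _) (sym εχ-0))
        at-≢0 : ∀ {x} → x ≢ F.0# → (_^χ_ F K η h) x ≡ εχ F K x
        at-≢0 x≢0 = trans (η.^χ-≢0 x≢0 h) (trans (u≡1 x≢0) (sym (εχ-≢0 x≢0)))

    eulerIntegral≡S-of-even-order : ∀ {N} → HasOrder F K η N → 2 < N → 2 ∣ N → ∀ {z} → z ≢ F.1# →
      eulerIntegral z ≡ (bar F K η (F.1# F.- z) K.^ 2) K.* S F K N η z
    eulerIntegral≡S-of-even-order {N} ord 2<N (divides h N≡h*2) {z} z≢1 =
      subst (λ n → HasOrder F K η n → 2 < n → eulerIntegral z ≡ (bar F K η (F.1# F.- z) K.^ 2) K.* S F K n η z)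
            (sym (trans N≡h*2 (n*2≡n+n h))) (of-half h) ord 2<N
      where
      of-half : ∀ h → HasOrder F K η (h + h) → 2 < h + h →
                eulerIntegral z ≡ (bar F K η (F.1# F.- z) K.^ 2) K.* S F K (h + h) η z
      of-half zero                _   ()
      of-half (suc zero)          _   2<2 = ⊥-elim (ℕ.<-irrefl refl 2<2)
      of-half h@(suc m@(suc _))   ord _   = eulerIntegral≡S-even m (s≤s z≤n) (η^[N/2]≡φ {h} ord (s≤s z≤n)) z≢1

    eulerIntegral≡S-of-odd-order : ∀ {N} → HasOrder F K η N → 2 < N → ¬ (2 ∣ N) → ∀ z →
      eulerIntegral z ≡ S F K (2 * N) ψ z
    eulerIntegral≡S-of-odd-order {N} ord 2<N 2∤N z with even-or-odd N
    ... | inj₁ (h , N≡h+h)   = ⊥-elim (2∤N (divides h (trans N≡h+h (sym (n*2≡n+n h)))))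
    ... | inj₂ (k , N≡1+k+k) =
      subst (λ n → HasOrder F K η n → 2 < n → eulerIntegral z ≡ S F K (2 * n) ψ z)
            (sym N≡1+k+k) (of-half k) ord 2<N
      where
      of-half : ∀ k → HasOrder F K η (suc (k + k)) → 2 < suc (k + k) →
                eulerIntegral z ≡ S F K (2 * suc (k + k)) ψ z
      of-half zero          _   (s≤s ())
      of-half k@(suc _)     ord _ = eulerIntegral≡S-odd k (s≤s z≤n) (^order≡1 ord) z

lemma3p2 :
    (F : FiniteField) (K : CharZeroField) →
    let module F = FiniteField F
        module K = CharZeroField K
    in ¬ (2 ∣ F.size) →
       (η : F.Carrier → K.Carrier) → IsCharacter F K η →
       (N : ℕ) → 2 < N → HasOrder F K η N →
       (z : F.Carrier) → z ≢ F.0# → z ≢ F.1# →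
       (2 ∣ N →
          ₂F₁ F K (_·χ_ F K (φ F K) η) η (φ F K) z
            ≡ (_·χ_ F K (φ F K) η (F.- F.1#) K.* q⁻¹ F K)
                K.* ((bar F K η (F.1# F.- z) K.^ 2) K.* S F K N η z))
       ×
       (¬ (2 ∣ N) →
          ₂F₁ F K (_·χ_ F K (φ F K) η) η (φ F K) z
            ≡ (_·χ_ F K (φ F K) η (F.- F.1#) K.* q⁻¹ F K)
                K.* S F K (2 * N) (_·χ_ F K (φ F K) (bar F K η)) z)
lemma3p2 F K odd η isη N 2<N ord z z≢0 z≢1 =
  (λ 2∣N → trans (₂F₁≡eulerIntegral isη z≢0)
                 (cong (prefactor K.*_) (eulerIntegral≡S-of-even-order isη ord 2<N 2∣N z≢1))) ,
  (λ 2∤N → trans (₂F₁≡eulerIntegral isη z≢0)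
                 (cong (prefactor K.*_) (eulerIntegral≡S-of-odd-order isη ord 2<N 2∤N z)))
  where
  module F = FiniteField F
  module K = CharZeroField K
  open Hypergeometric F K odd
  prefactor = _·χ_ F K (φ F K) η (F.- F.1#) K.* q⁻¹ F K
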